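{- Let $n,k,t,r,s$ be positive integers with $1\leq r\leq k$. Let $\overline{f}(n,k,t,r,s)$ be the number of $k$-tuples $(\alpha^1,\ldots,\alpha^k)$ of overpartitions with $|\alpha^1|+\cdots+|\alpha^k|=n$ and exactly $s$ overlined parts in total, such that $\max\{\ell(\alpha^1),\ldots,\ell(\alpha^k)\}=t$ and $r$ is the largest index with $\ell(\alpha^r)=t$. Let $\overline{g}(n,k,t,r,s)$ be the number of unrestricted Schmidt $k$-overpartitions of $n$ with exactly $s$ overlined parts and length exactly $(t-1)k+r$. Then $\overline{f}(n,k,t,r,s)=\overline{g}(n,k,t,r,s)$.
   Context: An overpartition is a partition (finite weakly decreasing sequence of positive integers, possibly empty) in which the final occurrence of each part value may be overlined; $\ell(\cdot)$ is its number of parts and $|\cdot|$ the sum of its parts. An unrestricted Schmidt $k$-overpartition of $n$ is an overpartition $(\lambda_1,\lambda_2,\ldots)$ with $\lambda_1+\lambda_{k+1}+\lambda_{2k+1}+\cdots=n$. -}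

module Defs where

open import Data.Nat using (ℕ; zero; suc; _+_; _*_; _∸_; _⊔_; _≤ᵇ_; _≡ᵇ_)
open import Data.Bool using (Bool; true; false; _∧_; _∨_; not; if_then_else_; T)
open import Data.List using (List; []; _∷_; map; length; foldr)
open import Data.Nat.ListAction using (sum)
open import Data.Vec using (Vec; toList)
open import Data.Product using (Σ; _×_; _,_; proj₁; proj₂)
open import Data.Fin using (Fin)
open import Function.Bundles using (_↔_)

-- A "marked" part: its value together with a flag telling whether it is overlined.
MarkedPart : Set
MarkedPart = ℕ × Bool

-- A list of marked parts is an overpartition iff all parts are positive,
-- the values are weakly decreasing, and only the final occurrence of a value
-- may be overlined (i.e. if λᵢ = λᵢ₊₁ then λᵢ is not overlined).
isOverpartition : List MarkedPart → Bool
isOverpartition [] = true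
isOverpartition ((a , o) ∷ []) = 1 ≤ᵇ a
isOverpartition ((a , o) ∷ (b , p) ∷ rest) =
  (1 ≤ᵇ a) ∧ (b ≤ᵇ a) ∧ (not (a ≡ᵇ b) ∨ not o) ∧ isOverpartition ((b , p) ∷ rest)

-- Overpartitions (the validity proof lives in T, hence is proof-irrelevant).
Overpartition : Set
Overpartition = Σ (List MarkedPart) (λ xs → T (isOverpartition xs))

parts : Overpartition → List ℕ
parts α = map proj₁ (proj₁ α)

len : Overpartition → ℕ
len α = length (proj₁ α)

size : Overpartition → ℕ
size α = sum (parts α)

numOverlined : Overpartition → ℕ
numOverlined α = sum (map (λ x → if proj₂ x then 1 else 0) (proj₁ α))

maxList : List ℕ → ℕ
maxList = foldr _⊔_ 0

-- largest 1-based index i with xsᵢ = t (0 if there is none)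
lastIndexOf : ℕ → List ℕ → ℕ
lastIndexOf t xs = go 1 xs 0
  where
  go : ℕ → List ℕ → ℕ → ℕ
  go i [] acc = acc
  go i (x ∷ ys) acc = go (suc i) ys (if x ≡ᵇ t then i else acc)

fCond : (n k t r s : ℕ) → Vec Overpartition k → Bool
fCond n k t r s αs =
  let as = toList αs
      ls = map len as
  in (sum (map size as) ≡ᵇ n) ∧ (sum (map numOverlined as) ≡ᵇ s)
     ∧ (maxList ls ≡ᵇ t) ∧ (lastIndexOf t ls ≡ᵇ r)

FSet : (n k t r s : ℕ) → Set
FSet n k t r s = Σ (Vec Overpartition k) (λ αs → T (fCond n k t r s αs))

-- λ₁ + λ_{k+1} + λ_{2k+1} + … (sum of the parts at 1-based positions ≡ 1 mod k)
schmidtSum : ℕ → List ℕ → ℕ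
schmidtSum k xs = go 0 xs
  where
  -- c = number of parts still to skip before the next counted part
  go : ℕ → List ℕ → ℕ
  go c [] = 0
  go zero (x ∷ ys) = x + go (k ∸ 1) ys
  go (suc c) (x ∷ ys) = go c ys

gCond : (n k t r s : ℕ) → Overpartition → Bool
gCond n k t r s α =
  (schmidtSum k (parts α) ≡ᵇ n) ∧ (numOverlined α ≡ᵇ s) ∧ (len α ≡ᵇ (t ∸ 1) * k + r)

GSet : (n k t r s : ℕ) → Set
GSet n k t r s = Σ Overpartition (λ α → T (gCond n k t r s α))

HasCard : Set → ℕ → Set
HasCard A c = A ↔ Fin c

{-# OPTIONS --safe #-}
module Submission where

-- An overpartition of length at most N is determined by its vector of differences
-- dᵢ = λᵢ − λᵢ₊₁ (after padding with zero parts), each carrying the overline of λᵢ, which can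
-- only sit on a positive difference. A k-tuple of overpartitions of length at most t thus
-- becomes a t × k array of differences, one column per overpartition, and reading the array
-- row by row gives the difference vector of an overpartition of length at most tk. As
-- λ_{(j−1)k+1} is the sum of rows j, j+1, …, the Schmidt sum of the reading weights row j by
-- j, exactly as the sizes of the columns do. Overlines are carried along, and the last nonzero
-- difference sits in row t, column r precisely when the columns have maximal length t with r
-- the last one attaining it, that is, when the reading has length (t − 1)k + r. Both sets
-- thus correspond to one set of arrays, which is finite since every difference is at most n.

open import Defs
open import Algebra.Bundles using (CommutativeMonoid)
open import Data.Bool using (Bool; true; false; _∧_; _∨_; not; if_then_else_; T)
open import Data.Bool.Properties using (T-∧; T-≡; T-irrelevant; ∧-zeroʳ; ∧-commutativeMonoid)
open import Data.Empty using (⊥-elim)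
open import Data.Fin as F using (Fin; toℕ)
open import Data.Fin.Properties using (0↔⊥; 1↔⊤; +↔⊎; *↔×; 2↔Bool)
open import Data.List as L using (List; []; _∷_; length)
open import Data.List.Properties using (map-++; map-replicate)
open import Data.Nat using (ℕ; zero; suc; _+_; _*_; _∸_; _≤ᵇ_; _≡ᵇ_; _≤_; _<_; z≤n; s≤s)
open import Data.Nat.ListAction using (sum)
open import Data.Nat.Properties
open import Data.Product using (Σ; _×_; _,_; proj₁; proj₂)
open import Data.Product.Function.Dependent.Propositional using (Σ-↔)
open import Data.Product.Function.NonDependent.Propositional using (_×-↔_)
open import Data.Sum using (_⊎_; inj₁; inj₂)
open import Data.Sum.Function.Propositional using (_⊎-↔_)
open import Data.Unit using (tt)
open import Data.Vec as V using (Vec; []; _∷_; _++_)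
open import Data.Vec.Properties
  using (map-cong; map-∘; toList-++; toList-map; length-toList; ++-injectiveˡ; ++-injectiveʳ)
open import Function using (_∘_)
open import Function.Bundles using (_↔_; mk↔ₛ′; Inverse; Equivalence)
open import Function.Properties.Inverse using (↔-refl; ↔-sym; ↔-trans)
open import Relation.Binary.PropositionalEquality using (_≡_; refl; sym; trans; cong; cong₂; subst; module ≡-Reasoning)
import Relation.Binary.PropositionalEquality as ≡

private
  variable
    A B : Set
    k m N t : ℕ

-- Finite subsets cut out by Boolean predicates

Σ-T-≡ : {p : A → Bool} {a a′ : A} {x : T (p a)} {y : T (p a′)} →
        a ≡ a′ → _≡_ {A = Σ A (T ∘ p)} (a , x) (a′ , y)
Σ-T-≡ refl = cong (_ ,_) (T-irrelevant _ _)

T-∧⁻ : ∀ a {b} → T (a ∧ b) → T a × T b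
T-∧⁻ a = Equivalence.to (T-∧ {a})

T-∧⁺ : ∀ {a b} → T a → T b → T (a ∧ b)
T-∧⁺ x y = Equivalence.from T-∧ (x , y)

T-cong-↔ : {a b : Bool} → a ≡ b → T a ↔ T b
T-cong-↔ refl = ↔-refl

Σ-T-retract-↔ : (f : A → B) (g : B → A) {p : A → Bool} {q : B → Bool} →
                (∀ {a} → T (p a) → T (q (f a))) →
                (∀ {a} → T (p a) → g (f a) ≡ a) →
                (∀ {b} → T (q b) → f (g b) ≡ b) →
                Σ A (T ∘ p) ↔ Σ B (λ b → T (q b ∧ p (g b)))
Σ-T-retract-↔ f g {p} {q} f-q g∘f f∘g = mk↔ₛ′ to from to∘from from∘to
  where
  to : Σ _ (T ∘ p) → Σ _ (λ b → T (q b ∧ p (g b)))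
  to (a , pa) = f a , T-∧⁺ (f-q pa) (subst (T ∘ p) (sym (g∘f pa)) pa)
  from : Σ _ (λ b → T (q b ∧ p (g b))) → Σ _ (T ∘ p)
  from (b , h) = g b , proj₂ (T-∧⁻ (q b) h)
  to∘from : ∀ y → to (from y) ≡ y
  to∘from (b , h) = Σ-T-≡ (f∘g (proj₁ (T-∧⁻ (q b) h)))
  from∘to : ∀ x → from (to x) ≡ x
  from∘to (a , pa) = Σ-T-≡ (g∘f pa)

Finite : Set → Set
Finite A = Σ ℕ (HasCard A)

finite-↔ : A ↔ B → Finite B → Finite A
finite-↔ A↔B (c , B↔c) = c , ↔-trans A↔B B↔c

finite-Fin : Finite (Fin m)
finite-Fin = _ , ↔-refl

finite-Bool : Finite Bool
finite-Bool = 2 , ↔-sym 2↔Bool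

finite-× : Finite A → Finite B → Finite (A × B)
finite-× (a , A↔a) (b , B↔b) = a * b , ↔-trans (A↔a ×-↔ B↔b) (↔-sym *↔×)

finite-Vec : Finite A → ∀ N → Finite (Vec A N)
finite-Vec _ zero = 1 , mk↔ₛ′ (λ _ → F.zero) (λ _ → []) (λ { F.zero → refl ; (F.suc ()) }) (λ { [] → refl })
finite-Vec finA (suc N) = finite-↔ uncons↔ (finite-× finA (finite-Vec finA N))
  where
  uncons↔ : Vec _ (suc N) ↔ (_ × Vec _ N)
  uncons↔ = mk↔ₛ′ V.uncons (λ (x , xs) → x ∷ xs) (λ _ → refl) (λ { (x ∷ xs) → refl })

finite-⊎ : Finite A → Finite B → Finite (A ⊎ B)
finite-⊎ (a , A↔a) (b , B↔b) = a + b , ↔-trans (A↔a ⊎-↔ B↔b) (↔-sym +↔⊎)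

finite-T : ∀ b → Finite (T b)
finite-T true = 1 , ↔-sym 1↔⊤
finite-T false = 0 , ↔-sym 0↔⊥

Σ-Fin-suc-↔ : (P : Fin (suc m) → Set) → Σ (Fin (suc m)) P ↔ (P F.zero ⊎ Σ (Fin m) (P ∘ F.suc))
Σ-Fin-suc-↔ P = mk↔ₛ′ split join split∘join join∘split
  where
  split : Σ _ P → P F.zero ⊎ Σ _ (P ∘ F.suc)
  split (F.zero , x) = inj₁ x
  split (F.suc i , x) = inj₂ (i , x)
  join : P F.zero ⊎ Σ _ (P ∘ F.suc) → Σ _ P
  join (inj₁ x) = F.zero , x
  join (inj₂ (i , x)) = F.suc i , x
  split∘join : ∀ y → split (join y) ≡ y
  split∘join (inj₁ x) = refl
  split∘join (inj₂ (i , x)) = refl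
  join∘split : ∀ y → join (split y) ≡ y
  join∘split (F.zero , x) = refl
  join∘split (F.suc i , x) = refl

finite-Σ-Fin-T : ∀ m (p : Fin m → Bool) → Finite (Σ (Fin m) (T ∘ p))
finite-Σ-Fin-T zero p = 0 , mk↔ₛ′ (λ { (() , _) }) (λ ()) (λ ()) (λ { (() , _) })
finite-Σ-Fin-T (suc m) p =
  finite-↔ (Σ-Fin-suc-↔ (T ∘ p)) (finite-⊎ (finite-T (p F.zero)) (finite-Σ-Fin-T m (p ∘ F.suc)))

finite-Σ-T : Finite A → (p : A → Bool) → Finite (Σ A (T ∘ p))
finite-Σ-T (m , A↔m) p =
  finite-↔ (Σ-T-retract-↔ to from (λ _ → tt) (λ _ → strictlyInverseʳ _) (λ _ → strictlyInverseˡ _))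
           (finite-Σ-Fin-T m (p ∘ from))
  where open Inverse A↔m

-- Arrays read row by row

rows : ∀ t → Vec (Vec A t) k → Vec (Vec A k) t
rows zero cols = []
rows (suc t) cols = V.map V.head cols ∷ rows t (V.map V.tail cols)

columns : Vec (Vec A k) t → Vec (Vec A t) k
columns [] = V.replicate _ []
columns (row ∷ rs) = V.zipWith _∷_ row (columns rs)

map-head-zipWith-∷ : (xs : Vec A k) (xss : Vec (Vec A t) k) → V.map V.head (V.zipWith _∷_ xs xss) ≡ xs
map-head-zipWith-∷ [] [] = refl
map-head-zipWith-∷ (x ∷ xs) (_ ∷ xss) = cong (x ∷_) (map-head-zipWith-∷ xs xss)

map-tail-zipWith-∷ : (xs : Vec A k) (xss : Vec (Vec A t) k) → V.map V.tail (V.zipWith _∷_ xs xss) ≡ xss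
map-tail-zipWith-∷ [] [] = refl
map-tail-zipWith-∷ (_ ∷ xs) (ys ∷ xss) = cong (ys ∷_) (map-tail-zipWith-∷ xs xss)

zipWith-∷-head-tail : (xss : Vec (Vec A (suc t)) k) → V.zipWith _∷_ (V.map V.head xss) (V.map V.tail xss) ≡ xss
zipWith-∷-head-tail [] = refl
zipWith-∷-head-tail ((x ∷ xs) ∷ xss) = cong ((x ∷ xs) ∷_) (zipWith-∷-head-tail xss)

replicate-[] : (xss : Vec (Vec A 0) k) → V.replicate k [] ≡ xss
replicate-[] [] = refl
replicate-[] ([] ∷ xss) = cong ([] ∷_) (replicate-[] xss)

columns-rows : ∀ t (cols : Vec (Vec A t) k) → columns (rows t cols) ≡ cols
columns-rows zero cols = replicate-[] cols
columns-rows (suc t) cols =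
  trans (cong (V.zipWith _∷_ (V.map V.head cols)) (columns-rows t (V.map V.tail cols)))
        (zipWith-∷-head-tail cols)

rows-columns : ∀ t (rs : Vec (Vec A k) t) → rows t (columns rs) ≡ rs
rows-columns zero [] = refl
rows-columns (suc t) (row ∷ rs) =
  cong₂ _∷_ (map-head-zipWith-∷ row (columns rs))
            (trans (cong (rows t) (map-tail-zipWith-∷ row (columns rs))) (rows-columns t rs))

rows↔ : ∀ t → Vec (Vec A t) k ↔ Vec (Vec A k) t
rows↔ t = mk↔ₛ′ (rows t) columns (rows-columns t) (columns-rows t)

concat-injective : (xss yss : Vec (Vec A k) t) → V.concat xss ≡ V.concat yss → xss ≡ yss
concat-injective [] [] _ = refl
concat-injective (xs ∷ xss) (ys ∷ yss) eq =
  cong₂ _∷_ (++-injectiveˡ xs ys eq) (concat-injective xss yss (++-injectiveʳ xs ys eq))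

concat↔ : ∀ t → Vec (Vec A k) t ↔ Vec A (t * k)
concat↔ {k = k} t = mk↔ₛ′ V.concat (proj₁ ∘ V.group t k)
  (λ xs → sym (proj₂ (V.group t k xs)))
  (λ xss → concat-injective _ xss (sym (proj₂ (V.group t k (V.concat xss)))))

rowMajor : ∀ t → Vec (Vec A t) k → Vec A (t * k)
rowMajor t = V.concat ∘ rows t

rowMajor↔ : ∀ t → Vec (Vec A t) k ↔ Vec A (t * k)
rowMajor↔ t = ↔-trans (rows↔ t) (concat↔ t)

module Fold {c ℓ} (M : CommutativeMonoid c ℓ) where
  open CommutativeMonoid M
    using (Carrier; _≈_; _∙_; ε; setoid; ∙-congˡ; ∙-congʳ; assoc; identityˡ; commutativeSemigroup)
    renaming (refl to ≈-refl; sym to ≈-sym)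
  open import Algebra.Properties.CommutativeSemigroup commutativeSemigroup using (interchange)
  open import Relation.Binary.Reasoning.Setoid setoid

  fold : (A → Carrier) → Vec A N → Carrier
  fold f [] = ε
  fold f (x ∷ xs) = f x ∙ fold f xs

  fold-cong : {f g : A → Carrier} → (∀ x → f x ≈ g x) → (xs : Vec A N) → fold f xs ≈ fold g xs
  fold-cong f≈g [] = ≈-refl
  fold-cong f≈g (x ∷ xs) = begin
    _ ∙ _ ≈⟨ ∙-congʳ (f≈g x) ⟩
    _ ∙ _ ≈⟨ ∙-congˡ (fold-cong f≈g xs) ⟩
    _ ∙ _ ∎

  fold-map : (f : B → Carrier) (g : A → B) (xs : Vec A N) → fold f (V.map g xs) ≡ fold (f ∘ g) xs
  fold-map f g [] = ≡.refl
  fold-map f g (x ∷ xs) = ≡.cong (f (g x) ∙_) (fold-map f g xs)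

  fold-ε : (xs : Vec A N) → fold (λ _ → ε) xs ≈ ε
  fold-ε [] = ≈-refl
  fold-ε (x ∷ xs) = begin
    ε ∙ fold (λ _ → ε) xs ≈⟨ identityˡ _ ⟩
    fold (λ _ → ε) xs     ≈⟨ fold-ε xs ⟩
    ε                     ∎

  fold-++ : (f : A → Carrier) (xs : Vec A m) (ys : Vec A N) → fold f (xs ++ ys) ≈ fold f xs ∙ fold f ys
  fold-++ f [] ys = ≈-sym (identityˡ _)
  fold-++ f (x ∷ xs) ys = begin
    f x ∙ fold f (xs ++ ys)         ≈⟨ ∙-congˡ (fold-++ f xs ys) ⟩
    f x ∙ (fold f xs ∙ fold f ys)   ≈⟨ assoc _ _ _ ⟨
    (f x ∙ fold f xs) ∙ fold f ys   ∎

  fold-∙ : (f g : A → Carrier) (xs : Vec A N) → fold (λ x → f x ∙ g x) xs ≈ fold f xs ∙ fold g xs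
  fold-∙ f g [] = ≈-sym (identityˡ ε)
  fold-∙ f g (x ∷ xs) = begin
    (f x ∙ g x) ∙ fold (λ x → f x ∙ g x) xs ≈⟨ ∙-congˡ (fold-∙ f g xs) ⟩
    (f x ∙ g x) ∙ (fold f xs ∙ fold g xs)   ≈⟨ interchange _ _ _ _ ⟩
    (f x ∙ fold f xs) ∙ (g x ∙ fold g xs)   ∎

  fold-head-tail : (g : A → Carrier) (h : Vec A t → Carrier) (cols : Vec (Vec A (suc t)) k) →
                   fold (λ col → g (V.head col) ∙ h (V.tail col)) cols
                     ≈ fold g (V.map V.head cols) ∙ fold h (V.map V.tail cols)
  fold-head-tail g h cols = begin
    fold (λ col → g (V.head col) ∙ h (V.tail col)) cols       ≈⟨ fold-∙ _ _ cols ⟩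
    fold (g ∘ V.head) cols ∙ fold (h ∘ V.tail) cols           ≡⟨ ≡.cong₂ _∙_ (≡.sym (fold-map g V.head cols))
                                                                           (≡.sym (fold-map h V.tail cols)) ⟩
    fold g (V.map V.head cols) ∙ fold h (V.map V.tail cols)   ∎

  fold-rowMajor : ∀ t (f : A → Carrier) (cols : Vec (Vec A t) k) → fold (fold f) cols ≈ fold f (rowMajor t cols)
  fold-rowMajor zero f cols = begin
    fold (fold f) cols ≈⟨ fold-cong (λ { [] → ≈-refl }) cols ⟩
    fold (λ _ → ε) cols ≈⟨ fold-ε cols ⟩
    ε ∎
  fold-rowMajor (suc t) f cols = begin
    fold (fold f) cols
      ≈⟨ fold-cong (λ { (_ ∷ _) → ≈-refl }) cols ⟩
    fold (λ col → f (V.head col) ∙ fold f (V.tail col)) cols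
      ≈⟨ fold-head-tail f (fold f) cols ⟩
    fold f heads ∙ fold (fold f) tails
      ≈⟨ ∙-congˡ (fold-rowMajor t f tails) ⟩
    fold f heads ∙ fold f (rowMajor t tails)
      ≈⟨ fold-++ f heads (rowMajor t tails) ⟨
    fold f (rowMajor (suc t) cols) ∎
    where
    heads = V.map V.head cols
    tails = V.map V.tail cols

module Additive = Fold +-0-commutativeMonoid
module Conjunctive = Fold ∧-commutativeMonoid

-- Statistics of lists

consIndex : Bool → ℕ → ℕ
consIndex b zero = if b then 1 else 0
consIndex b (suc i) = suc (suc i)

-- 1-based position of the last entry satisfying p, and 0 if there is none.
lastIndex : (A → Bool) → List A → ℕ
lastIndex p [] = 0
lastIndex p (x ∷ xs) = consIndex (p x) (lastIndex p xs)

lastIndex-≤-length : (p : A → Bool) (xs : List A) → lastIndex p xs ≤ length xs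
lastIndex-≤-length p [] = z≤n
lastIndex-≤-length p (x ∷ xs) with lastIndex p xs | lastIndex-≤-length p xs
... | suc i | i<length = s≤s i<length
... | zero | _ with p x
...   | true = s≤s z≤n
...   | false = z≤n

lastIndex-cong : {p q : A → Bool} → (∀ x → p x ≡ q x) → (xs : List A) → lastIndex p xs ≡ lastIndex q xs
lastIndex-cong p≗q [] = refl
lastIndex-cong p≗q (x ∷ xs) = cong₂ consIndex (p≗q x) (lastIndex-cong p≗q xs)

lastIndex-map : (p : B → Bool) (f : A → B) (xs : List A) → lastIndex p (L.map f xs) ≡ lastIndex (p ∘ f) xs
lastIndex-map p f [] = refl
lastIndex-map p f (x ∷ xs) = cong (consIndex (p (f x))) (lastIndex-map p f xs)

lastIndex-++-zero : (p : A → Bool) (xs : List A) {ys : List A} →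
                    lastIndex p ys ≡ 0 → lastIndex p (xs L.++ ys) ≡ lastIndex p xs
lastIndex-++-zero p [] eq = eq
lastIndex-++-zero p (x ∷ xs) eq = cong (consIndex (p x)) (lastIndex-++-zero p xs eq)

lastIndex-++-suc : (p : A → Bool) (xs : List A) {ys : List A} {i : ℕ} →
                   lastIndex p ys ≡ suc i → lastIndex p (xs L.++ ys) ≡ length xs + suc i
lastIndex-++-suc p [] eq = eq
lastIndex-++-suc p (x ∷ xs) {i = i} eq =
  trans (cong (consIndex (p x)) (trans (lastIndex-++-suc p xs eq) (+-suc (length xs) i)))
        (cong suc (sym (+-suc (length xs) i)))

lastIndex-++-≤ : (p : A → Bool) (xs ys : List A) → lastIndex p (xs L.++ ys) ≤ length xs + lastIndex p ys
lastIndex-++-≤ p xs ys with lastIndex p ys in eq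
... | zero = ≤-trans (≤-reflexive (lastIndex-++-zero p xs eq))
                     (≤-trans (lastIndex-≤-length p xs) (m≤m+n (length xs) 0))
... | suc i = ≤-reflexive (lastIndex-++-suc p xs eq)

lastIndex-≡ᵇ-length : (p : A → Bool) (xs : Vec A (suc t)) →
                      (lastIndex p (V.toList xs) ≡ᵇ suc t) ≡ p (V.last xs)
lastIndex-≡ᵇ-length p (x ∷ []) with p x
... | true = refl
... | false = refl
lastIndex-≡ᵇ-length {t = suc t} p (x ∷ y ∷ ys)
  with lastIndex p (V.toList (y ∷ ys)) | lastIndex-≡ᵇ-length p (y ∷ ys)
... | suc i | eq = eq
... | zero | eq with p x
...   | true = eq
...   | false = eq

indexFrom : ℕ → ℕ → ℕ → ℕ
indexFrom i acc zero = acc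
indexFrom i acc (suc j) = i + j

accumulated-lastIndex : (p : A → Bool) {g : ℕ → List A → ℕ → ℕ} →
  (∀ i acc → g i [] acc ≡ acc) →
  (∀ i x xs acc → g i (x ∷ xs) acc ≡ g (suc i) xs (if p x then i else acc)) →
  ∀ i xs acc → g i xs acc ≡ indexFrom i acc (lastIndex p xs)
accumulated-lastIndex p g-[] g-∷ i [] acc = g-[] i acc
accumulated-lastIndex p {g} g-[] g-∷ i (x ∷ xs) acc =
  trans (g-∷ i x xs acc)
        (trans (accumulated-lastIndex p {g} g-[] g-∷ (suc i) xs _) (indexFrom-consIndex (p x) (lastIndex p xs)))
  where
  indexFrom-consIndex : ∀ b j → indexFrom (suc i) (if b then i else acc) j ≡ indexFrom i acc (consIndex b j)
  indexFrom-consIndex b (suc j) = sym (+-suc i j)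
  indexFrom-consIndex true zero = sym (+-identityʳ i)
  indexFrom-consIndex false zero = refl

-- The local `go` of lastIndexOf cannot be named. Abstracting the constants it is called with
-- turns `g i xs acc ≟ go i xs acc` into a pattern, so unification instantiates g with it.
lastIndexOf-lastIndex : ∀ t xs → lastIndexOf t xs ≡ lastIndex (_≡ᵇ t) xs
lastIndexOf-lastIndex t xs = trans (viaAccumulator xs) (indexFrom-1-0 (lastIndex (_≡ᵇ t) xs))
  where
  viaAccumulator : ∀ xs → lastIndexOf t xs ≡ indexFrom 1 0 (lastIndex (_≡ᵇ t) xs)
  viaAccumulator with 1 | 0 | accumulated-lastIndex (_≡ᵇ t) (λ _ _ → refl) (λ _ _ _ _ → refl)
  ... | i | acc | accumulated = λ xs → accumulated i xs acc
  indexFrom-1-0 : ∀ j → indexFrom 1 0 j ≡ j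
  indexFrom-1-0 zero = refl
  indexFrom-1-0 (suc j) = refl

maxList-map-≤ : (f : A → ℕ) → (∀ x → f x ≤ t) → (xs : List A) → maxList (L.map f xs) ≤ t
maxList-map-≤ f f≤t [] = z≤n
maxList-map-≤ f f≤t (x ∷ xs) = ⊔-lub (f≤t x) (maxList-map-≤ f f≤t xs)

lastIndex-≡ᵇ⇒≤-maxList : ∀ t xs {i} → lastIndex (_≡ᵇ t) xs ≡ suc i → t ≤ maxList xs
lastIndex-≡ᵇ⇒≤-maxList t (x ∷ xs) eq with lastIndex (_≡ᵇ t) xs in eq′
... | suc j = ≤-trans (lastIndex-≡ᵇ⇒≤-maxList t xs eq′) (m≤n⊔m x (maxList xs))
... | zero with x ≡ᵇ t in x≡ᵇt
...   | true = ≤-trans (≤-reflexive (sym (≡ᵇ⇒≡ x t (subst T (sym x≡ᵇt) tt)))) (m≤m⊔n x (maxList xs))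

-- strideSum k c xs adds the entries of xs at positions c, c + k, c + 2k, … (counted from 0).
strideSum : ℕ → ℕ → List ℕ → ℕ
strideSum k c [] = 0
strideSum k zero (x ∷ xs) = x + strideSum k (k ∸ 1) xs
strideSum k (suc c) (x ∷ xs) = strideSum k c xs

strideSum-unique : ∀ k {g : ℕ → List ℕ → ℕ} →
  (∀ c → g c [] ≡ 0) →
  (∀ x xs → g 0 (x ∷ xs) ≡ x + g (k ∸ 1) xs) →
  (∀ c x xs → g (suc c) (x ∷ xs) ≡ g c xs) →
  ∀ c xs → g c xs ≡ strideSum k c xs
strideSum-unique k g-[] g-0 g-suc c [] = g-[] c
strideSum-unique k {g} g-[] g-0 g-suc zero (x ∷ xs) =
  trans (g-0 x xs) (cong (x +_) (strideSum-unique k {g} g-[] g-0 g-suc (k ∸ 1) xs))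
strideSum-unique k {g} g-[] g-0 g-suc (suc c) (x ∷ xs) =
  trans (g-suc c x xs) (strideSum-unique k {g} g-[] g-0 g-suc c xs)

-- As for lastIndexOf; here schmidtSum's `go` ignores its enclosing list, so `0 ∷ xs` serves for
-- every `x ∷ xs`.
schmidtSum-strideSum : ∀ k xs → schmidtSum k xs ≡ strideSum k 0 xs
schmidtSum-strideSum k [] = refl
schmidtSum-strideSum k (x ∷ xs) = cong (x +_) (schmidtSum-0∷ xs)
  where
  schmidtSum-0∷ : ∀ xs → schmidtSum k (0 ∷ xs) ≡ strideSum k (k ∸ 1) xs
  schmidtSum-0∷ with k ∸ 1 | strideSum-unique k (λ _ → refl) (λ _ _ → refl) (λ _ _ _ → refl)
  ... | c | unique = λ xs → unique c xs

sum-strideSum : ∀ xs → sum xs ≡ strideSum 1 0 xs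
sum-strideSum [] = refl
sum-strideSum (x ∷ xs) = cong (x +_) (sum-strideSum xs)

strideSum-++-zeros : ∀ k c xs m → strideSum k c (xs L.++ L.replicate m 0) ≡ strideSum k c xs
strideSum-++-zeros k c [] m = zeros c m
  where
  zeros : ∀ c m → strideSum k c (L.replicate m 0) ≡ 0
  zeros c zero = refl
  zeros zero (suc m) = zeros (k ∸ 1) m
  zeros (suc c) (suc m) = zeros c m
strideSum-++-zeros k zero (x ∷ xs) m = cong (x +_) (strideSum-++-zeros k (k ∸ 1) xs m)
strideSum-++-zeros k (suc c) (x ∷ xs) m = strideSum-++-zeros k c xs m

-- Overpartitions as vectors of differences

headValue : List MarkedPart → ℕ
headValue [] = 0
headValue (x ∷ _) = proj₁ x

top : Vec MarkedPart N → ℕ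
top [] = 0
top (x ∷ _) = proj₁ x

Dominates : MarkedPart → ℕ → Set
Dominates (a , o) b = b ≤ a × (T o → b < a)

Dominates-≤ : ∀ x {b c} → c ≤ b → Dominates x b → Dominates x c
Dominates-≤ x c≤b (b≤a , b<a) = ≤-trans c≤b b≤a , λ o → ≤-<-trans c≤b (b<a o)

data Descending : Vec MarkedPart N → Set where
  [] : Descending []
  step : ∀ {x} {xs : Vec MarkedPart N} → Dominates x (top xs) → Descending xs → Descending (x ∷ xs)

isOverpartition-∷⁻ : ∀ a o xs → T (isOverpartition ((a , o) ∷ xs)) →
                     1 ≤ a × Dominates (a , o) (headValue xs) × T (isOverpartition xs)
isOverpartition-∷⁻ a o [] 1≤a = ≤ᵇ⇒≤ 1 a 1≤a , (z≤n , λ _ → ≤ᵇ⇒≤ 1 a 1≤a) , tt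
isOverpartition-∷⁻ a o ((b , p) ∷ xs) h =
  let 1≤a , h′ = T-∧⁻ (1 ≤ᵇ a) h
      b≤a , h″ = T-∧⁻ (b ≤ᵇ a) h′
      distinct , rest = T-∧⁻ (not (a ≡ᵇ b) ∨ not o) h″
  in ≤ᵇ⇒≤ 1 a 1≤a , (≤ᵇ⇒≤ b a b≤a , strict o (≤ᵇ⇒≤ b a b≤a) distinct) , rest
  where
  strict : ∀ o → b ≤ a → T (not (a ≡ᵇ b) ∨ not o) → T o → b < a
  strict true b≤a distinct _ with a ≡ᵇ b in a≡ᵇb
  ... | false = ≤∧≢⇒< b≤a λ b≡a → subst T a≡ᵇb (≡⇒≡ᵇ a b (sym b≡a))

isOverpartition-∷⁺ : ∀ a o xs → 1 ≤ a → Dominates (a , o) (headValue xs) → T (isOverpartition xs) →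
                     T (isOverpartition ((a , o) ∷ xs))
isOverpartition-∷⁺ a o [] 1≤a _ _ = ≤⇒≤ᵇ 1≤a
isOverpartition-∷⁺ a o ((b , p) ∷ xs) 1≤a (b≤a , b<a) h =
  T-∧⁺ (≤⇒≤ᵇ 1≤a) (T-∧⁺ (≤⇒≤ᵇ b≤a) (T-∧⁺ (distinct o b<a) h))
  where
  distinct : ∀ o → (T o → b < a) → T (not (a ≡ᵇ b) ∨ not o)
  distinct false _ with a ≡ᵇ b
  ... | true = tt
  ... | false = tt
  distinct true b<a with a ≡ᵇ b in a≡ᵇb
  ... | false = tt
  ... | true = ⊥-elim (<⇒≢ (b<a tt) (sym (≡ᵇ⇒≡ a b (subst T (sym a≡ᵇb) tt))))

pad : ∀ N → List MarkedPart → Vec MarkedPart N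
pad zero _ = []
pad (suc N) [] = (0 , false) ∷ pad N []
pad (suc N) (x ∷ xs) = x ∷ pad N xs

positivePrefix : List MarkedPart → List MarkedPart
positivePrefix [] = []
positivePrefix ((zero , o) ∷ xs) = []
positivePrefix ((suc a , o) ∷ xs) = (suc a , o) ∷ positivePrefix xs

differences : Vec MarkedPart N → Vec MarkedPart N
differences [] = []
differences ((a , o) ∷ xs) = (a ∸ top xs , o) ∷ differences xs

-- A zero difference loses its overline, so that accumulate always yields a Descending vector.
accumulate : Vec MarkedPart N → Vec MarkedPart N
accumulate [] = []
accumulate ((d , o) ∷ xs) = (d + top (accumulate xs) , o ∧ (1 ≤ᵇ d)) ∷ accumulate xs

overlinable : MarkedPart → Bool
overlinable (d , false) = true
overlinable (d , true) = 1 ≤ᵇ d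

admissible : Vec MarkedPart N → Bool
admissible = Conjunctive.fold overlinable

allAdmissible : Vec (Vec MarkedPart N) k → Bool
allAdmissible = Conjunctive.fold admissible

top-pad-[] : ∀ N → top (pad N []) ≡ 0
top-pad-[] zero = refl
top-pad-[] (suc N) = refl

top-pad : ∀ N xs → top (pad N xs) ≤ headValue xs
top-pad zero xs = z≤n
top-pad (suc N) [] = z≤n
top-pad (suc N) (x ∷ xs) = ≤-refl

pad-descending : ∀ N xs → T (isOverpartition xs) → Descending (pad N xs)
pad-descending zero xs _ = []
pad-descending (suc N) [] _ = step (≤-reflexive (top-pad-[] N) , λ ()) (pad-descending N [] tt)
pad-descending (suc N) ((a , o) ∷ xs) h =
  let _ , dominates , h′ = isOverpartition-∷⁻ a o xs h
  in step (Dominates-≤ (a , o) (top-pad N xs) dominates) (pad-descending N xs h′)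

positivePrefix-pad : ∀ N xs → T (isOverpartition xs) → length xs ≤ N → positivePrefix (V.toList (pad N xs)) ≡ xs
positivePrefix-pad zero [] _ _ = refl
positivePrefix-pad (suc N) [] _ _ = refl
positivePrefix-pad (suc N) ((zero , o) ∷ xs) h _ with isOverpartition-∷⁻ zero o xs h
... | () , _
positivePrefix-pad (suc N) ((suc a , o) ∷ xs) h (s≤s len≤N) =
  cong ((suc a , o) ∷_) (positivePrefix-pad N xs (proj₂ (proj₂ (isOverpartition-∷⁻ (suc a) o xs h))) len≤N)

accumulate-differences : {w : Vec MarkedPart N} → Descending w → accumulate (differences w) ≡ w
accumulate-differences [] = refl
accumulate-differences (step {x = a , o} {xs} (b≤a , b<a) w↓)
  rewrite accumulate-differences w↓ = cong₂ (λ a′ o′ → (a′ , o′) ∷ xs) (m∸n+n≡m b≤a) (keep-overline o b<a)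
  where
  keep-overline : ∀ o → (T o → top xs < a) → o ∧ (1 ≤ᵇ (a ∸ top xs)) ≡ o
  keep-overline false _ = refl
  keep-overline true b<a = Equivalence.to T-≡ (≤⇒≤ᵇ (m<n⇒0<n∸m (b<a tt)))

differences-accumulate : (v : Vec MarkedPart N) → T (admissible v) → differences (accumulate v) ≡ v
differences-accumulate [] _ = refl
differences-accumulate ((d , o) ∷ xs) h =
  let ok , h′ = T-∧⁻ (overlinable (d , o)) h
  in cong₂ _∷_ (cong₂ _,_ (m+n∸n≡m d (top (accumulate xs))) (keep-overline o ok)) (differences-accumulate xs h′)
  where
  keep-overline : ∀ o → T (overlinable (d , o)) → o ∧ (1 ≤ᵇ d) ≡ o
  keep-overline false _ = refl
  keep-overline true ok = Equivalence.to T-≡ ok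

accumulate-descending : (v : Vec MarkedPart N) → Descending (accumulate v)
accumulate-descending [] = []
accumulate-descending ((d , o) ∷ xs) =
  step (m≤n+m _ d , λ o∧1≤d → +-monoˡ-≤ _ (≤ᵇ⇒≤ 1 d (proj₂ (T-∧⁻ o o∧1≤d)))) (accumulate-descending xs)

descending-top-zero : {w : Vec MarkedPart N} → Descending w → top w ≡ 0 → w ≡ pad N []
descending-top-zero [] _ = refl
descending-top-zero (step {x = zero , o} (b≤0 , b<0) w↓) refl
  with top-zero ← n≤0⇒n≡0 b≤0 with o
... | false = cong ((0 , false) ∷_) (descending-top-zero w↓ top-zero)
... | true = ⊥-elim (<-irrefl top-zero (b<0 tt))

pad-positivePrefix : {w : Vec MarkedPart N} → Descending w → pad N (positivePrefix (V.toList w)) ≡ w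
pad-positivePrefix [] = refl
pad-positivePrefix w↓@(step {x = zero , o} _ _) = sym (descending-top-zero w↓ refl)
pad-positivePrefix (step {x = suc a , o} _ w↓) = cong ((suc a , o) ∷_) (pad-positivePrefix w↓)

headValue-positivePrefix : (w : Vec MarkedPart N) → headValue (positivePrefix (V.toList w)) ≤ top w
headValue-positivePrefix [] = z≤n
headValue-positivePrefix ((zero , o) ∷ xs) = z≤n
headValue-positivePrefix ((suc a , o) ∷ xs) = ≤-refl

positivePrefix-overpartition : {w : Vec MarkedPart N} → Descending w → T (isOverpartition (positivePrefix (V.toList w)))
positivePrefix-overpartition [] = tt
positivePrefix-overpartition (step {x = zero , o} _ _) = tt
positivePrefix-overpartition (step {x = suc a , o} {xs} dominates w↓) =
  isOverpartition-∷⁺ (suc a) o (positivePrefix (V.toList xs)) (s≤s z≤n)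
                      (Dominates-≤ (suc a , o) (headValue-positivePrefix xs) dominates)
                      (positivePrefix-overpartition w↓)

length-positivePrefix : (xs : List MarkedPart) → length (positivePrefix xs) ≤ length xs
length-positivePrefix [] = z≤n
length-positivePrefix ((zero , o) ∷ xs) = z≤n
length-positivePrefix ((suc a , o) ∷ xs) = s≤s (length-positivePrefix xs)

admissible-differences : {w : Vec MarkedPart N} → Descending w → T (admissible (differences w))
admissible-differences [] = tt
admissible-differences (step {x = _ , false} _ w↓) = admissible-differences w↓
admissible-differences (step {x = _ , true} (_ , b<a) w↓) =
  T-∧⁺ (≤⇒≤ᵇ (m<n⇒0<n∸m (b<a tt))) (admissible-differences w↓)

encode : ∀ N → Overpartition → Vec MarkedPart N
encode N α = differences (pad N (proj₁ α))

decode : Vec MarkedPart N → Overpartition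
decode v = positivePrefix (V.toList (accumulate v)) , positivePrefix-overpartition (accumulate-descending v)

decode-encode : ∀ N (α : Overpartition) → len α ≤ N → decode (encode N α) ≡ α
decode-encode N (xs , xs-op) len≤N = Σ-T-≡ (begin
  positivePrefix (V.toList (accumulate (differences (pad N xs))))
    ≡⟨ cong (positivePrefix ∘ V.toList) (accumulate-differences (pad-descending N xs xs-op)) ⟩
  positivePrefix (V.toList (pad N xs))
    ≡⟨ positivePrefix-pad N xs xs-op len≤N ⟩
  xs ∎)
  where open ≡-Reasoning

encode-decode : ∀ N (v : Vec MarkedPart N) → T (admissible v) → encode N (decode v) ≡ v
encode-decode N v v-ok = begin
  differences (pad N (positivePrefix (V.toList (accumulate v))))
    ≡⟨ cong differences (pad-positivePrefix (accumulate-descending v)) ⟩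
  differences (accumulate v)
    ≡⟨ differences-accumulate v v-ok ⟩
  v ∎
  where open ≡-Reasoning

len-decode : (v : Vec MarkedPart N) → len (decode v) ≤ N
len-decode v = ≤-trans (length-positivePrefix (V.toList (accumulate v))) (≤-reflexive (length-toList (accumulate v)))

admissible-encode : ∀ N (α : Overpartition) → T (admissible (encode N α))
admissible-encode N (xs , xs-op) = admissible-differences (pad-descending N xs xs-op)

-- Statistics of difference vectors

total : Vec MarkedPart N → ℕ
total = Additive.fold proj₁

mark : MarkedPart → ℕ
mark x = if proj₂ x then 1 else 0

overlines : Vec MarkedPart N → ℕ
overlines = Additive.fold mark

nonzero : MarkedPart → Bool
nonzero x = 1 ≤ᵇ proj₁ x

lastNonzero : Vec MarkedPart N → ℕ
lastNonzero v = lastIndex nonzero (V.toList v)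

heights : Vec MarkedPart N → List ℕ
heights [] = []
heights (x ∷ xs) = proj₁ x + total xs ∷ heights xs

total-differences : {w : Vec MarkedPart N} → Descending w → total (differences w) ≡ top w
total-differences [] = refl
total-differences (step (b≤a , _) w↓) rewrite total-differences w↓ = m∸n+n≡m b≤a

heights-differences : {w : Vec MarkedPart N} → Descending w → heights (differences w) ≡ L.map proj₁ (V.toList w)
heights-differences [] = refl
heights-differences (step (b≤a , _) w↓) rewrite total-differences w↓ =
  cong₂ _∷_ (m∸n+n≡m b≤a) (heights-differences w↓)

toList-pad : ∀ N xs → length xs ≤ N → V.toList (pad N xs) ≡ xs L.++ L.replicate (N ∸ length xs) (0 , false)
toList-pad zero [] _ = refl
toList-pad (suc N) [] _ = cong ((0 , false) ∷_) (toList-pad N [] z≤n)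
toList-pad (suc N) (x ∷ xs) (s≤s len≤N) = cong (x ∷_) (toList-pad N xs len≤N)

strideSum-encode : ∀ k c N (α : Overpartition) → len α ≤ N →
                   strideSum k c (parts α) ≡ strideSum k c (heights (encode N α))
strideSum-encode k c N (xs , xs-op) len≤N = begin
  strideSum k c (L.map proj₁ xs)
    ≡⟨ strideSum-++-zeros k c (L.map proj₁ xs) (N ∸ length xs) ⟨
  strideSum k c (L.map proj₁ xs L.++ L.replicate (N ∸ length xs) 0)
    ≡⟨ cong (strideSum k c) (sym padded-values) ⟩
  strideSum k c (L.map proj₁ (V.toList (pad N xs)))
    ≡⟨ cong (strideSum k c) (heights-differences (pad-descending N xs xs-op)) ⟨
  strideSum k c (heights (differences (pad N xs))) ∎
  where
  open ≡-Reasoning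
  padded-values : L.map proj₁ (V.toList (pad N xs)) ≡ L.map proj₁ xs L.++ L.replicate (N ∸ length xs) 0
  padded-values = trans (cong (L.map proj₁) (toList-pad N xs len≤N))
                        (trans (map-++ proj₁ xs _) (cong (L.map proj₁ xs L.++_) (map-replicate proj₁ _ _)))

size-encode : ∀ N (α : Overpartition) → len α ≤ N → size α ≡ strideSum 1 0 (heights (encode N α))
size-encode N α len≤N = trans (sum-strideSum (parts α)) (strideSum-encode 1 0 N α len≤N)

schmidtSum-encode : ∀ k N (α : Overpartition) → len α ≤ N →
                    schmidtSum k (parts α) ≡ strideSum k 0 (heights (encode N α))
schmidtSum-encode k N α len≤N = trans (schmidtSum-strideSum k (parts α)) (strideSum-encode k 0 N α len≤N)

overlines-differences : (w : Vec MarkedPart N) → overlines (differences w) ≡ overlines w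
overlines-differences [] = refl
overlines-differences (x ∷ w) = cong (mark x +_) (overlines-differences w)

overlines-pad : ∀ N xs → length xs ≤ N → overlines (pad N xs) ≡ sum (L.map mark xs)
overlines-pad zero [] _ = refl
overlines-pad (suc N) [] _ = overlines-pad N [] z≤n
overlines-pad (suc N) (x ∷ xs) (s≤s len≤N) = cong (mark x +_) (overlines-pad N xs len≤N)

numOverlined-encode : ∀ N (α : Overpartition) → len α ≤ N → numOverlined α ≡ overlines (encode N α)
numOverlined-encode N (xs , _) len≤N = sym (trans (overlines-differences (pad N xs)) (overlines-pad N xs len≤N))

lastNonzero-differences-pad : ∀ N xs → T (isOverpartition xs) → length xs ≤ N →
                              lastNonzero (differences (pad N xs)) ≡ length xs
lastNonzero-differences-pad zero [] _ _ = refl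
lastNonzero-differences-pad (suc N) [] _ _
  rewrite lastNonzero-differences-pad N [] tt z≤n | top-pad-[] N = refl
lastNonzero-differences-pad (suc N) ((a , o) ∷ []) h _
  rewrite lastNonzero-differences-pad N [] tt z≤n | top-pad-[] N with a | proj₁ (isOverpartition-∷⁻ a o [] h)
... | suc _ | _ = refl
lastNonzero-differences-pad (suc N) ((a , o) ∷ y ∷ ys) h (s≤s len≤N)
  rewrite lastNonzero-differences-pad N (y ∷ ys) (proj₂ (proj₂ (isOverpartition-∷⁻ a o (y ∷ ys) h))) len≤N = refl

len-encode : ∀ N (α : Overpartition) → len α ≤ N → len α ≡ lastNonzero (encode N α)
len-encode N (xs , xs-op) len≤N = sym (lastNonzero-differences-pad N xs xs-op len≤N)

decode-stat : (f : Overpartition → B) (g : Vec MarkedPart N → B) →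
              (∀ α → len α ≤ N → f α ≡ g (encode N α)) →
              (v : Vec MarkedPart N) → T (admissible v) → f (decode v) ≡ g v
decode-stat {N = N} f g f≡g∘encode v v-ok =
  trans (f≡g∘encode (decode v) (len-decode v)) (cong g (encode-decode N v v-ok))

map-decode-stat : (f : Overpartition → B) (g : Vec MarkedPart N → B) →
                  (∀ α → len α ≤ N → f α ≡ g (encode N α)) →
                  (cols : Vec (Vec MarkedPart N) k) → T (allAdmissible cols) →
                  L.map f (V.toList (V.map decode cols)) ≡ L.map g (V.toList cols)
map-decode-stat f g f≡g∘encode [] _ = refl
map-decode-stat f g f≡g∘encode (col ∷ cols) ok =
  let col-ok , cols-ok = T-∧⁻ (admissible col) ok
  in cong₂ _∷_ (decode-stat f g f≡g∘encode col col-ok) (map-decode-stat f g f≡g∘encode cols cols-ok)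

-- Statistics of an array and of its row-major reading

strideSum-heights-skip : ∀ k {c m} (ys : Vec MarkedPart c) (rest : Vec MarkedPart m) →
                         strideSum k c (heights (ys ++ rest)) ≡ strideSum k 0 (heights rest)
strideSum-heights-skip k [] rest = refl
strideSum-heights-skip k (y ∷ ys) rest = strideSum-heights-skip k ys rest

strideSum-heights-++ : ∀ k (row : Vec MarkedPart (suc k)) (rest : Vec MarkedPart m) →
                       strideSum (suc k) 0 (heights (row ++ rest))
                         ≡ (total row + total rest) + strideSum (suc k) 0 (heights rest)
strideSum-heights-++ k (x ∷ ys) rest = begin
  (proj₁ x + total (ys ++ rest)) + strideSum (suc k) k (heights (ys ++ rest))
    ≡⟨ cong₂ _+_ (cong (proj₁ x +_) (Additive.fold-++ proj₁ ys rest)) (strideSum-heights-skip (suc k) ys rest) ⟩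
  (proj₁ x + (total ys + total rest)) + strideSum (suc k) 0 (heights rest)
    ≡⟨ cong (_+ strideSum (suc k) 0 (heights rest)) (+-assoc (proj₁ x) (total ys) (total rest)) ⟨
  (total (x ∷ ys) + total rest) + strideSum (suc k) 0 (heights rest) ∎
  where open ≡-Reasoning

-- Both sides weight the entries of row j by j.
size-rowMajor : ∀ k t (cols : Vec (Vec MarkedPart t) (suc k)) →
                Additive.fold (strideSum 1 0 ∘ heights) cols ≡ strideSum (suc k) 0 (heights (rowMajor t cols))
size-rowMajor k zero cols = trans (Additive.fold-cong (λ { [] → refl }) cols) (Additive.fold-ε cols)
size-rowMajor k (suc t) cols = begin
  Additive.fold (strideSum 1 0 ∘ heights) cols
    ≡⟨ Additive.fold-cong (λ { (x ∷ col) → +-assoc (proj₁ x) (total col) _ }) cols ⟩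
  Additive.fold (λ col → proj₁ (V.head col) + (total (V.tail col) + S (V.tail col))) cols
    ≡⟨ Additive.fold-head-tail proj₁ (λ col → total col + S col) cols ⟩
  total heads + Additive.fold (λ col → total col + S col) tails
    ≡⟨ cong (total heads +_) (Additive.fold-∙ total S tails) ⟩
  total heads + (Additive.fold total tails + Additive.fold S tails)
    ≡⟨ cong (total heads +_) (cong₂ _+_ (Additive.fold-rowMajor t proj₁ tails) (size-rowMajor k t tails)) ⟩
  total heads + (total rest + strideSum (suc k) 0 (heights rest))
    ≡⟨ +-assoc (total heads) (total rest) _ ⟨
  (total heads + total rest) + strideSum (suc k) 0 (heights rest)
    ≡⟨ strideSum-heights-++ k heads rest ⟨
  strideSum (suc k) 0 (heights (rowMajor (suc t) cols)) ∎
  where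
  open ≡-Reasoning
  S : Vec MarkedPart t → ℕ
  S = strideSum 1 0 ∘ heights
  heads = V.map V.head cols
  tails = V.map V.tail cols
  rest = rowMajor t tails

last-rows : ∀ t (cols : Vec (Vec A (suc t)) k) → V.last (rows (suc t) cols) ≡ V.map V.last cols
last-rows zero cols = map-cong (λ { (x ∷ []) → refl }) cols
last-rows (suc t) cols = begin
  V.last (rows (suc t) (V.map V.tail cols))   ≡⟨ last-rows t (V.map V.tail cols) ⟩
  V.map V.last (V.map V.tail cols)            ≡⟨ map-∘ V.last V.tail cols ⟨
  V.map (V.last ∘ V.tail) cols                ≡⟨ map-cong (λ { (x ∷ y ∷ xs) → refl }) cols ⟩
  V.map V.last cols                           ∎
  where open ≡-Reasoning

lastIndex-concat-suc : ∀ (p : A → Bool) t (xss : Vec (Vec A k) (suc t)) {i} →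
                       lastIndex p (V.toList (V.last xss)) ≡ suc i →
                       lastIndex p (V.toList (V.concat xss)) ≡ t * k + suc i
lastIndex-concat-suc p zero (xs ∷ []) eq =
  trans (cong (lastIndex p) (toList-++ xs [])) (trans (lastIndex-++-zero p (V.toList xs) refl) eq)
lastIndex-concat-suc {k = k} p (suc t) (xs ∷ xss) {i} eq = begin
  lastIndex p (V.toList (xs ++ V.concat xss))               ≡⟨ cong (lastIndex p) (toList-++ xs (V.concat xss)) ⟩
  lastIndex p (V.toList xs L.++ V.toList (V.concat xss))    ≡⟨ lastIndex-++-suc p (V.toList xs)
                                                                 (trans (lastIndex-concat-suc p t xss eq) (+-suc (t * k) i)) ⟩
  length (V.toList xs) + suc (t * k + i)                    ≡⟨ cong₂ _+_ (length-toList xs) (sym (+-suc (t * k) i)) ⟩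
  k + (t * k + suc i)                                       ≡⟨ +-assoc k (t * k) (suc i) ⟨
  suc t * k + suc i                                         ∎
  where open ≡-Reasoning

lastIndex-concat-zero : ∀ (p : A → Bool) t (xss : Vec (Vec A k) (suc t)) →
                        lastIndex p (V.toList (V.last xss)) ≡ 0 →
                        lastIndex p (V.toList (V.concat xss)) ≤ t * k
lastIndex-concat-zero p zero (xs ∷ []) eq =
  ≤-reflexive (trans (cong (lastIndex p) (toList-++ xs [])) (trans (lastIndex-++-zero p (V.toList xs) refl) eq))
lastIndex-concat-zero {k = k} p (suc t) (xs ∷ xss) eq = begin
  lastIndex p (V.toList (xs ++ V.concat xss))                 ≡⟨ cong (lastIndex p) (toList-++ xs (V.concat xss)) ⟩
  lastIndex p (V.toList xs L.++ V.toList (V.concat xss))      ≤⟨ lastIndex-++-≤ p (V.toList xs) _ ⟩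
  length (V.toList xs) + lastIndex p (V.toList (V.concat xss)) ≤⟨ +-mono-≤ (≤-reflexive (length-toList xs))
                                                                               (lastIndex-concat-zero p t xss eq) ⟩
  k + t * k                                                    ∎
  where open ≤-Reasoning

≡ᵇ-refl : ∀ n → (n ≡ᵇ n) ≡ true
≡ᵇ-refl n = Equivalence.to T-≡ (≡⇒≡ᵇ n n refl)

<⇒≡ᵇ-false : ∀ {m n} → m < n → (m ≡ᵇ n) ≡ false
<⇒≡ᵇ-false {m} {n} m<n with m ≡ᵇ n in eq
... | false = refl
... | true = ⊥-elim (<⇒≢ m<n (≡ᵇ⇒≡ m n (subst T (sym eq) tt)))

+-cancelˡ-≡ᵇ : ∀ a b c → (a + b ≡ᵇ a + c) ≡ (b ≡ᵇ c)
+-cancelˡ-≡ᵇ zero b c = refl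
+-cancelˡ-≡ᵇ (suc a) b c = +-cancelˡ-≡ᵇ a b c

-- A column of height t + 1 has length t + 1 exactly when its last difference is nonzero.
lastIndexOf-lastNonzero : ∀ t (cols : Vec (Vec MarkedPart (suc t)) k) →
                          lastIndexOf (suc t) (L.map lastNonzero (V.toList cols))
                            ≡ lastIndex nonzero (V.toList (V.map V.last cols))
lastIndexOf-lastNonzero t cols = begin
  lastIndexOf (suc t) lengths                     ≡⟨ lastIndexOf-lastIndex (suc t) lengths ⟩
  lastIndex (_≡ᵇ suc t) lengths                   ≡⟨ lastIndex-map (_≡ᵇ suc t) lastNonzero (V.toList cols) ⟩
  lastIndex ((_≡ᵇ suc t) ∘ lastNonzero) (V.toList cols)
                                                  ≡⟨ lastIndex-cong (lastIndex-≡ᵇ-length nonzero) (V.toList cols) ⟩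
  lastIndex (nonzero ∘ V.last) (V.toList cols)    ≡⟨ lastIndex-map nonzero V.last (V.toList cols) ⟨
  lastIndex nonzero (L.map V.last (V.toList cols)) ≡⟨ cong (lastIndex nonzero) (toList-map V.last cols) ⟨
  lastIndex nonzero (V.toList (V.map V.last cols)) ∎
  where
  open ≡-Reasoning
  lengths = L.map lastNonzero (V.toList cols)

lastNonzero-rowMajor-suc : ∀ t (cols : Vec (Vec MarkedPart (suc t)) k) {i} →
                           lastIndex nonzero (V.toList (V.map V.last cols)) ≡ suc i →
                           lastNonzero (rowMajor (suc t) cols) ≡ t * k + suc i
lastNonzero-rowMajor-suc t cols eq =
  lastIndex-concat-suc nonzero t (rows (suc t) cols) (trans (cong (lastIndex nonzero ∘ V.toList) (last-rows t cols)) eq)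

lastNonzero-rowMajor-zero : ∀ t (cols : Vec (Vec MarkedPart (suc t)) k) →
                            lastIndex nonzero (V.toList (V.map V.last cols)) ≡ 0 →
                            lastNonzero (rowMajor (suc t) cols) ≤ t * k
lastNonzero-rowMajor-zero t cols eq =
  lastIndex-concat-zero nonzero t (rows (suc t) cols) (trans (cong (lastIndex nonzero ∘ V.toList) (last-rows t cols)) eq)

length-condition : ∀ t r (cols : Vec (Vec MarkedPart (suc t)) k) →
                   let ls = L.map lastNonzero (V.toList cols) in
                   (maxList ls ≡ᵇ suc t) ∧ (lastIndexOf (suc t) ls ≡ᵇ suc r)
                     ≡ (lastNonzero (rowMajor (suc t) cols) ≡ᵇ t * k + suc r)
length-condition {k = k} t r cols
  rewrite lastIndexOf-lastNonzero t cols
  with lastIndex nonzero (V.toList (V.map V.last cols)) in eq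
... | zero = trans (∧-zeroʳ _)
                   (sym (<⇒≡ᵇ-false (≤-<-trans (lastNonzero-rowMajor-zero t cols eq) (m<m+n (t * k) (s≤s z≤n)))))
... | suc i = begin
  (maxList ls ≡ᵇ suc t) ∧ (suc i ≡ᵇ suc r)        ≡⟨ cong (λ m → (m ≡ᵇ suc t) ∧ (suc i ≡ᵇ suc r)) maxList-ls ⟩
  (suc t ≡ᵇ suc t) ∧ (suc i ≡ᵇ suc r)             ≡⟨ cong (_∧ (suc i ≡ᵇ suc r)) (≡ᵇ-refl t) ⟩
  suc i ≡ᵇ suc r                                  ≡⟨ +-cancelˡ-≡ᵇ (t * k) (suc i) (suc r) ⟨
  t * k + suc i ≡ᵇ t * k + suc r                  ≡⟨ cong (_≡ᵇ t * k + suc r) (lastNonzero-rowMajor-suc t cols eq) ⟨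
  lastNonzero (rowMajor (suc t) cols) ≡ᵇ t * k + suc r ∎
  where
  open ≡-Reasoning
  ls = L.map lastNonzero (V.toList cols)
  maxList-ls : maxList ls ≡ suc t
  maxList-ls = ≤-antisym
    (maxList-map-≤ lastNonzero
      (λ col → ≤-trans (lastIndex-≤-length nonzero (V.toList col)) (≤-reflexive (length-toList col))) (V.toList cols))
    (lastIndex-≡ᵇ⇒≤-maxList (suc t) ls
      (trans (sym (lastIndexOf-lastIndex (suc t) ls)) (trans (lastIndexOf-lastNonzero t cols) eq)))

sum-toList : (f : A → ℕ) (xs : Vec A N) → sum (L.map f (V.toList xs)) ≡ Additive.fold f xs
sum-toList f [] = refl
sum-toList f (x ∷ xs) = cong (f x +_) (sum-toList f xs)

fCond≡gCond-rowMajor : ∀ n k t r s (cols : Vec (Vec MarkedPart (suc t)) (suc k)) →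
                       T (allAdmissible cols) →
                       fCond n (suc k) (suc t) (suc r) s (V.map decode cols)
                         ≡ gCond n (suc k) (suc t) (suc r) s (decode (rowMajor (suc t) cols))
fCond≡gCond-rowMajor n k t r s cols cols-ok =
  cong₂ _∧_ (cong (_≡ᵇ n) sizes) (cong₂ _∧_ (cong (_≡ᵇ s) overlineCounts) lengths)
  where
  open ≡-Reasoning
  flat = rowMajor (suc t) cols
  flat-ok : T (admissible flat)
  flat-ok = subst T (Conjunctive.fold-rowMajor (suc t) overlinable cols) cols-ok
  sizes : sum (L.map size (V.toList (V.map decode cols))) ≡ schmidtSum (suc k) (parts (decode flat))
  sizes = begin
    sum (L.map size (V.toList (V.map decode cols)))
                                  ≡⟨ cong sum (map-decode-stat size (strideSum 1 0 ∘ heights) (size-encode (suc t)) cols cols-ok) ⟩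
    sum (L.map (strideSum 1 0 ∘ heights) (V.toList cols))  ≡⟨ sum-toList (strideSum 1 0 ∘ heights) cols ⟩
    Additive.fold (strideSum 1 0 ∘ heights) cols           ≡⟨ size-rowMajor k (suc t) cols ⟩
    strideSum (suc k) 0 (heights flat)                     ≡⟨ decode-stat (schmidtSum (suc k) ∘ parts) (strideSum (suc k) 0 ∘ heights)
                                                                (schmidtSum-encode (suc k) _) flat flat-ok ⟨
    schmidtSum (suc k) (parts (decode flat))               ∎
  overlineCounts : sum (L.map numOverlined (V.toList (V.map decode cols))) ≡ numOverlined (decode flat)
  overlineCounts = begin
    sum (L.map numOverlined (V.toList (V.map decode cols)))
                                  ≡⟨ cong sum (map-decode-stat numOverlined overlines (numOverlined-encode (suc t)) cols cols-ok) ⟩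
    sum (L.map overlines (V.toList cols))                   ≡⟨ sum-toList overlines cols ⟩
    Additive.fold overlines cols                            ≡⟨ Additive.fold-rowMajor (suc t) mark cols ⟩
    overlines flat                                          ≡⟨ decode-stat numOverlined overlines (numOverlined-encode _) flat flat-ok ⟨
    numOverlined (decode flat)                              ∎
  lengths : let ls = L.map len (V.toList (V.map decode cols)) in
            (maxList ls ≡ᵇ suc t) ∧ (lastIndexOf (suc t) ls ≡ᵇ suc r) ≡ (len (decode flat) ≡ᵇ t * suc k + suc r)
  lengths = begin
    _ ≡⟨ cong (λ ls → (maxList ls ≡ᵇ suc t) ∧ (lastIndexOf (suc t) ls ≡ᵇ suc r))
              (map-decode-stat len lastNonzero (len-encode (suc t)) cols cols-ok) ⟩
    _ ≡⟨ length-condition t r cols ⟩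
    _ ≡⟨ cong (_≡ᵇ t * suc k + suc r) (decode-stat len lastNonzero (len-encode _) flat flat-ok) ⟨
    _ ∎

-- The two counted sets as sets of difference vectors

∧-cong-T : ∀ {a b x y} → a ≡ b → (T a → x ≡ y) → a ∧ x ≡ b ∧ y
∧-cong-T {false} refl _ = refl
∧-cong-T {true} refl x≡y = x≡y tt

T-∧-proj₂ : ∀ a {b} → T (a ∧ b) → T b
T-∧-proj₂ a = proj₂ ∘ T-∧⁻ a

admissible-map-encode : (αs : Vec Overpartition k) → T (allAdmissible (V.map (encode t) αs))
admissible-map-encode [] = tt
admissible-map-encode {t = t} (α ∷ αs) = T-∧⁺ (admissible-encode t α) (admissible-map-encode αs)

map-decode-encode : (αs : Vec Overpartition k) → maxList (L.map len (V.toList αs)) ≤ t →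
                    V.map decode (V.map (encode t) αs) ≡ αs
map-decode-encode [] _ = refl
map-decode-encode {t = t} (α ∷ αs) max≤t =
  cong₂ _∷_ (decode-encode t α (≤-trans (m≤m⊔n _ _) max≤t))
            (map-decode-encode αs (≤-trans (m≤n⊔m (len α) _) max≤t))

map-encode-decode : (cols : Vec (Vec MarkedPart t) k) → T (allAdmissible cols) →
                    V.map (encode t) (V.map decode cols) ≡ cols
map-encode-decode [] _ = refl
map-encode-decode {t = t} (col ∷ cols) ok =
  let col-ok , cols-ok = T-∧⁻ (admissible col) ok
  in cong₂ _∷_ (encode-decode t col col-ok) (map-encode-decode cols cols-ok)

FSet↔columns : ∀ n k t r s →
  FSet n k t r s
    ↔ Σ (Vec (Vec MarkedPart t) k) (λ cols → T (allAdmissible cols ∧ fCond n k t r s (V.map decode cols)))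
FSet↔columns n k t r s = Σ-T-retract-↔ (V.map (encode t)) (V.map decode)
  (λ {αs} _ → admissible-map-encode αs)
  (λ {αs} h → map-decode-encode αs (≤-reflexive (maxList≡t αs h)))
  (λ {cols} → map-encode-decode cols)
  where
  maxList≡t : ∀ αs → T (fCond n k t r s αs) → maxList (L.map len (V.toList αs)) ≡ t
  maxList≡t αs h =
    ≡ᵇ⇒≡ _ t (proj₁ (T-∧⁻ (maxList lengths ≡ᵇ t)
                          (T-∧-proj₂ (sum overlineCounts ≡ᵇ s) (T-∧-proj₂ (sum sizes ≡ᵇ n) h))))
    where
    sizes = L.map size (V.toList αs)
    overlineCounts = L.map numOverlined (V.toList αs)
    lengths = L.map len (V.toList αs)

GSet↔differences : ∀ n k t r s N → (t ∸ 1) * k + r ≤ N →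
  GSet n k t r s ↔ Σ (Vec MarkedPart N) (λ v → T (admissible v ∧ gCond n k t r s (decode v)))
GSet↔differences n k t r s N length≤N = Σ-T-retract-↔ (encode N) decode
  (λ {α} _ → admissible-encode N α)
  (λ {α} h → decode-encode N α (≤-trans (≤-reflexive (len≡ α h)) length≤N))
  (λ {v} → encode-decode N v)
  where
  len≡ : ∀ α → T (gCond n k t r s α) → len α ≡ (t ∸ 1) * k + r
  len≡ α h = ≡ᵇ⇒≡ (len α) _ (T-∧-proj₂ (numOverlined α ≡ᵇ s) (T-∧-proj₂ (schmidtSum k (parts α) ≡ᵇ n) h))

columns↔rowMajor : ∀ n k t r s →
  Σ (Vec (Vec MarkedPart (suc t)) (suc k))
    (λ cols → T (allAdmissible cols ∧ fCond n (suc k) (suc t) (suc r) s (V.map decode cols)))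
    ↔ Σ (Vec MarkedPart (suc t * suc k)) (λ v → T (admissible v ∧ gCond n (suc k) (suc t) (suc r) s (decode v)))
columns↔rowMajor n k t r s = Σ-↔ (rowMajor↔ (suc t)) (λ {cols} → T-cong-↔
  (∧-cong-T (Conjunctive.fold-rowMajor (suc t) overlinable cols) (fCond≡gCond-rowMajor n k t r s cols)))

clamp : ∀ n → ℕ → Fin (suc n)
clamp zero _ = F.zero
clamp (suc n) zero = F.zero
clamp (suc n) (suc d) = F.suc (clamp n d)

toℕ-clamp : ∀ n {d} → d ≤ n → toℕ (clamp n d) ≡ d
toℕ-clamp zero z≤n = refl
toℕ-clamp (suc n) z≤n = refl
toℕ-clamp (suc n) (s≤s d≤n) = cong suc (toℕ-clamp n d≤n)

clamp-toℕ : ∀ n (i : Fin (suc n)) → clamp n (toℕ i) ≡ i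
clamp-toℕ zero F.zero = refl
clamp-toℕ (suc n) F.zero = refl
clamp-toℕ (suc n) (F.suc i) = cong F.suc (clamp-toℕ n i)

finite-bounded : ∀ n N (p : Vec MarkedPart N → Bool) → (∀ {v} → T (p v) → total v ≤ n) →
                 Finite (Σ (Vec MarkedPart N) (T ∘ p))
finite-bounded n N p bounded =
  finite-↔ (Σ-T-retract-↔ (V.map bound) (V.map unbound)
                          (λ _ → tt) (λ pv → unbound-bound _ (bounded pv)) (λ _ → bound-unbound _))
           (finite-Σ-T (finite-Vec (finite-× finite-Fin finite-Bool) N) _)
  where
  bound : MarkedPart → Fin (suc n) × Bool
  bound (d , o) = clamp n d , o
  unbound : Fin (suc n) × Bool → MarkedPart
  unbound (i , o) = toℕ i , o
  unbound-bound : ∀ {N} (v : Vec MarkedPart N) → total v ≤ n → V.map unbound (V.map bound v) ≡ v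
  unbound-bound [] _ = refl
  unbound-bound ((d , o) ∷ v) d+v≤n =
    cong₂ _∷_ (cong (_, o) (toℕ-clamp n (m+n≤o⇒m≤o d d+v≤n))) (unbound-bound v (m+n≤o⇒n≤o d d+v≤n))
  bound-unbound : ∀ {N} (w : Vec (Fin (suc n) × Bool) N) → V.map bound (V.map unbound w) ≡ w
  bound-unbound [] = refl
  bound-unbound ((i , o) ∷ w) = cong₂ _∷_ (cong (_, o) (clamp-toℕ n i)) (bound-unbound w)

total≤strideSum-heights : ∀ k (v : Vec MarkedPart N) → total v ≤ strideSum k 0 (heights v)
total≤strideSum-heights k [] = z≤n
total≤strideSum-heights k (x ∷ v) = m≤m+n (proj₁ x + total v) _

finite-differences : ∀ n k t r s N →
  Finite (Σ (Vec MarkedPart N) (λ v → T (admissible v ∧ gCond n k t r s (decode v))))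
finite-differences n k t r s N = finite-bounded n N _ λ {v} h →
  let v-ok , h′ = T-∧⁻ (admissible v) h
      schmidt≡n = ≡ᵇ⇒≡ _ n (proj₁ (T-∧⁻ (schmidtSum k (parts (decode v)) ≡ᵇ n) h′))
  in ≤-trans (total≤strideSum-heights k v)
             (≤-reflexive (trans (sym (decode-stat (schmidtSum k ∘ parts) (strideSum k 0 ∘ heights)
                                                   (schmidtSum-encode k N) v v-ok))
                                 schmidt≡n))

theorem10 : (n k t r s : ℕ) → 1 ≤ n → 1 ≤ k → 1 ≤ t → 1 ≤ r → r ≤ k → 1 ≤ s →
    Σ ℕ (λ c → HasCard (FSet n k t r s) c × HasCard (GSet n k t r s) c)
theorem10 n (suc k) (suc t) (suc r) s _ _ _ _ r≤k _ =
  count , ↔-trans F↔D (↔-trans (columns↔rowMajor n k t r s) D↔count) , ↔-trans G↔D D↔count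
  where
  F↔D = FSet↔columns n (suc k) (suc t) (suc r) s
  G↔D = GSet↔differences n (suc k) (suc t) (suc r) s (suc t * suc k)
          (≤-trans (+-monoʳ-≤ (t * suc k) r≤k) (≤-reflexive (+-comm (t * suc k) (suc k))))
  D-finite = finite-differences n (suc k) (suc t) (suc r) s (suc t * suc k)
  count = proj₁ D-finite
  D↔count = proj₂ D-finite
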